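{- For every fixed integer $l\ge 2$, we have $M_l(2n,n)=(1+o(1))\,n^{3/2}$ as $n\to\infty$.
   Context: For positive integers $l,n,k$, $M_l(n,k)$ denotes the maximum number of edges in an $n$-vertex bipartite graph $G=(V,E)$ whose edge set is the union $E=E_1\cup\cdots\cup E_k$ of $k$ matchings which are $l$-separated, meaning: each $E_i$ is a matching, and there is no sequence of vertices $a_0,a_1,\ldots,a_t$ with $t\le l$ such that $a_0$ and $a_t$ are incident to two distinct edges from the same $E_i$ (one to each) and each of $a_0a_1, a_1a_2,\ldots,a_{t-1}a_t$ is an edge of $E$. -}

module Defs where

open import Data.Nat using (ℕ; zero; suc; _+_; _*_; _^_; _≤_; _<ᵇ_)
open import Data.Fin using (Fin; zero; suc; toℕ; inject₁; fromℕ)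
open import Data.Bool using (Bool; true; false; if_then_else_)
open import Data.List using (List; map; allFin)
open import Data.Nat.ListAction using (sum)
open import Data.Bool.ListAction using (any)
open import Data.Product using (Σ; _×_; ∃)
open import Data.Sum using (_⊎_)
open import Relation.Binary.PropositionalEquality using (_≡_; _≢_)
open import Relation.Nullary using (¬_)

record Matchings (n k : ℕ) : Set where
  field
    M         : Fin k → Fin n → Fin n → Bool
    symmetric : ∀ i u v → M i u v ≡ M i v u
    loopless  : ∀ i u → M i u u ≡ false
    matching  : ∀ i u v w → M i u v ≡ true → M i u w ≡ true → v ≡ w

  adj : Fin n → Fin n → Bool
  adj u v = any (λ i → M i u v) (allFin k)

  Edge : Fin n → Fin n → Set
  Edge u v = adj u v ≡ true

  edgeCount : ℕ
  edgeCount = sum (map (λ u → sum (map (λ v → pairCount u v) (allFin n))) (allFin n))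
    where
    pairCount : Fin n → Fin n → ℕ
    pairCount u v = if toℕ u <ᵇ toℕ v then (if adj u v then 1 else 0) else 0

  Bipartite : Set
  Bipartite = Σ (Fin n → Bool) λ c → ∀ u v → Edge u v → c u ≢ c v

  Walk : (t : ℕ) → (Fin (suc t) → Fin n) → Set
  Walk t a = ∀ (j : Fin t) → Edge (a (inject₁ j)) (a (suc j))

  record Violation (l : ℕ) : Set where
    field
      i     : Fin k
      t     : ℕ
      t≤l   : t ≤ l
      a     : Fin (suc t) → Fin n
      walk  : Walk t a
      y w   : Fin n
      e∈Ei  : M i (a zero) y ≡ true
      f∈Ei  : M i (a (fromℕ t)) w ≡ true
      e≢f   : ¬ (((a zero ≡ a (fromℕ t)) × (y ≡ w)) ⊎ ((a zero ≡ w) × (y ≡ a (fromℕ t))))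

  Separated : ℕ → Set
  Separated l = ¬ Violation l

-- An admissible graph for M_l(n,k): n-vertex bipartite graph whose edge set
-- is the union of k l-separated matchings.
record Admissible (l n k : ℕ) : Set where
  field
    matchings : Matchings n k
    bipartite : Matchings.Bipartite matchings
    separated : Matchings.Separated matchings l

  edges : ℕ
  edges = Matchings.edgeCount matchings

module Submission where

-- Upper bound: a neighbour u of v is covered by deg u of the matchings, and no E_i covers two
-- neighbours u, u' of v (u v u' would be a walk of length 2 between distinct edges of E_i); so
-- Σ_{u ~ v} deg u ≤ k for every vertex v. Summing over v gives Σ_u (deg u)² ≤ N k, and
-- Cauchy–Schwarz turns this into (2|E|)² ≤ N² k, i.e. |E|² ≤ n³ for N = 2n and k = n.
-- Lower bound: for s = ⌊√n⌋ take ⌊n/s⌋ vertex-disjoint copies of K_{s,s} between the two halves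
-- and give the s² edges of each copy distinct colours, reusing the same s² ≤ n colours in every
-- copy. Distinct edges of one colour lie in different components, so the matchings are
-- l-separated for every l, and there are ⌊n/s⌋ s² = (1 − o(1)) n^{3/2} edges.

open import Data.Bool.Base using (Bool; true; false; if_then_else_)
open import Data.Bool.ListAction using (any; or)
open import Data.Bool.Properties using (T-≡; ¬-not)
open import Data.Empty using (⊥; ⊥-elim)
open import Data.Fin.Base using (Fin; zero; suc; toℕ; fromℕ; inject₁; fromℕ<)
import Data.Fin.Properties as Fin
open import Data.List.Base using (allFin; map; tabulate)
open import Data.List.Membership.Propositional using (lose)
open import Data.List.Membership.Propositional.Properties using (∈-allFin)
open import Data.List.Properties using (map-tabulate; map-cong)
open import Data.List.Relation.Unary.Any using (satisfied)
open import Data.List.Relation.Unary.Any.Properties using (any⁺; any⁻)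
open import Data.Nat.Base
open import Data.Nat.DivMod
import Data.Nat.ListAction as List
open import Data.Nat.Properties
open import Algebra.Properties.Semiring.Sum +-*-semiring
  using (sum-syntax; ∑-comm; ∑-distrib-+; *-distribˡ-sum; *-distribʳ-sum; sum-remove; sum-cong-≗)
open import Data.Nat.Tactic.RingSolver using (solve-∀)
open import Data.Product using (Σ; ∃; _×_; _,_; proj₁; proj₂)
open import Data.Sum using (_⊎_; inj₁; inj₂; swap)
open import Function.Base using (_∘_; case_of_)
open import Function.Bundles using (Equivalence; mk⇔)
open import Relation.Binary.PropositionalEquality
open import Relation.Nullary using (¬_; Dec; yes; no; does)
open import Relation.Nullary.Decidable using (_×-dec_; _⊎-dec_; dec-true; dec-false; does-⇔)
open import Relation.Nullary.Reflects using (Reflects; invert)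

open import Defs

open Equivalence using (to; from)

⟦_⟧ : Bool → ℕ
⟦ b ⟧ = if b then 1 else 0

⟦⟧≤1 : ∀ b → ⟦ b ⟧ ≤ 1
⟦⟧≤1 true  = ≤-refl
⟦⟧≤1 false = z≤n

⟦⟧-positive : ∀ {b} → 0 < ⟦ b ⟧ → b ≡ true
⟦⟧-positive {true} _ = refl

⟦⟧*-positive : ∀ b n → 0 < ⟦ b ⟧ * n → b ≡ true × 0 < n
⟦⟧*-positive true n 0<n = refl , subst (0 <_) (+-identityʳ n) 0<n

sum-allFin : ∀ n (f : Fin n → ℕ) → List.sum (map f (allFin n)) ≡ ∑[ i < n ] f i
sum-allFin n f = trans (cong List.sum (map-tabulate (λ i → i) f)) (sum-tabulate n f)
  where
  sum-tabulate : ∀ n (f : Fin n → ℕ) → List.sum (tabulate f) ≡ ∑[ i < n ] f i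
  sum-tabulate zero    f = refl
  sum-tabulate (suc n) f = cong (f zero +_) (sum-tabulate n (λ i → f (suc i)))

∑-const : ∀ n c → ∑[ i < n ] c ≡ n * c
∑-const zero    c = refl
∑-const (suc n) c = cong (c +_) (∑-const n c)

∑-mono-≤ : ∀ {n} {f g : Fin n → ℕ} → (∀ i → f i ≤ g i) → ∑[ i < n ] f i ≤ ∑[ i < n ] g i
∑-mono-≤ {zero}  f≤g = z≤n
∑-mono-≤ {suc n} f≤g = +-mono-≤ (f≤g zero) (∑-mono-≤ (λ i → f≤g (suc i)))

≤-∑ : ∀ {n} (f : Fin n → ℕ) i → f i ≤ ∑[ j < n ] f j
≤-∑ {suc n} f i = ≤-trans (m≤m+n (f i) _) (≤-reflexive (sym (sum-remove {i = i} f)))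

∑-positive : ∀ {n} (f : Fin n → ℕ) → 0 < ∑[ i < n ] f i → ∃ λ i → 0 < f i
∑-positive {suc n} f 0<∑ with f zero in eq
... | suc _ = zero , subst (0 <_) (sym eq) z<s
... | zero with ∑-positive (λ i → f (suc i)) 0<∑
...   | i , 0<fi = suc i , 0<fi

∑-≤1 : ∀ {n} (f : Fin n → ℕ) → (∀ i → f i ≤ 1) → (∀ i j → 0 < f i → 0 < f j → i ≡ j) →
       ∑[ i < n ] f i ≤ 1
∑-≤1 {zero}  f f≤1 unique = z≤n
∑-≤1 {suc n} f f≤1 unique with f zero in eq
... | zero  = ∑-≤1 (λ i → f (suc i)) (λ i → f≤1 (suc i))
                (λ i j 0<fi 0<fj → Fin.suc-injective (unique _ _ 0<fi 0<fj))
... | suc m = +-mono-≤ (subst (_≤ 1) eq (f≤1 zero)) rest≤0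
  where
  others-zero : ∀ i → f (suc i) ≤ 0
  others-zero i = ≮⇒≥ λ 0<fi → Fin.0≢1+n (unique zero (suc i) (subst (0 <_) (sym eq) z<s) 0<fi)
  rest≤0 : ∑[ i < n ] f (suc i) ≤ 0
  rest≤0 = ≤-trans (∑-mono-≤ others-zero) (≤-reflexive (trans (∑-const n 0) (*-zeroʳ n)))

interval-≤-∑ : ∀ {N} (f : Fin N → ℕ) {m} lo len → lo + len ≤ N →
               (∀ x → lo ≤ toℕ x → toℕ x < lo + len → m ≤ f x) → len * m ≤ ∑[ x < N ] f x
interval-≤-∑ {N}     f zero    zero    _         _     = z≤n
interval-≤-∑ {suc N} f zero    (suc len) (s≤s bound) f≥m =
  +-mono-≤ (f≥m zero z≤n z<s) (interval-≤-∑ (λ x → f (suc x)) zero len bound (λ x _ x<len → f≥m (suc x) z≤n (s≤s x<len)))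
interval-≤-∑ {suc N} f (suc lo) len    (s≤s bound) f≥m =
  ≤-trans (interval-≤-∑ (λ x → f (suc x)) lo len bound (λ x lo≤x x<hi → f≥m (suc x) (s≤s lo≤x) (s≤s x<hi)))
          (m≤n+m _ (f zero))

x≤y⇒2xy≤x²+y² : ∀ {x y} → x ≤ y → 2 * (x * y) ≤ x * x + y * y
x≤y⇒2xy≤x²+y² {x} {y} x≤y = subst (λ z → 2 * (x * z) ≤ x * x + z * z) (m+[n∸m]≡n x≤y)
  (subst (2 * (x * (x + d)) ≤_) (square-gap x d) (m≤m+n _ (d * d)))
  where
  d = y ∸ x
  square-gap : ∀ x d → 2 * (x * (x + d)) + d * d ≡ x * x + (x + d) * (x + d)
  square-gap = solve-∀

2xy≤x²+y² : ∀ x y → 2 * (x * y) ≤ x * x + y * y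
2xy≤x²+y² x y with ≤-total x y
... | inj₁ x≤y = x≤y⇒2xy≤x²+y² x≤y
... | inj₂ y≤x = subst₂ _≤_ (cong (2 *_) (*-comm y x)) (+-comm (y * y) (x * x)) (x≤y⇒2xy≤x²+y² y≤x)

∑²≤n*∑-squares : ∀ {n} (f : Fin n → ℕ) → ∑[ i < n ] f i * ∑[ i < n ] f i ≤ n * ∑[ i < n ] (f i * f i)
∑²≤n*∑-squares {n} f = *-cancelˡ-≤ 2 (begin
  2 * (S * S)                                             ≡⟨ cong (2 *_) (*-distribʳ-sum S f) ⟩
  2 * ∑[ i < n ] (f i * S)                                ≡⟨ *-distribˡ-sum 2 (λ i → f i * S) ⟩
  ∑[ i < n ] (2 * (f i * S))                              ≡⟨ sum-cong-≗ {n} (λ i → cong (2 *_) (*-distribˡ-sum (f i) f)) ⟩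
  ∑[ i < n ] (2 * ∑[ j < n ] (f i * f j))                 ≡⟨ sum-cong-≗ {n} (λ i → *-distribˡ-sum 2 (λ j → f i * f j)) ⟩
  ∑[ i < n ] ∑[ j < n ] (2 * (f i * f j))                 ≤⟨ ∑-mono-≤ (λ i → ∑-mono-≤ (λ j → 2xy≤x²+y² (f i) (f j))) ⟩
  ∑[ i < n ] ∑[ j < n ] (f i * f i + f j * f j)           ≡⟨ sum-cong-≗ {n} (λ i → ∑-distrib-+ (λ _ → f i * f i) (λ j → f j * f j)) ⟩
  ∑[ i < n ] (∑[ j < n ] (f i * f i) + Q)                 ≡⟨ ∑-distrib-+ (λ i → ∑[ j < n ] (f i * f i)) (λ _ → Q) ⟩
  ∑[ i < n ] ∑[ j < n ] (f i * f i) + ∑[ i < n ] Q        ≡⟨ cong₂ _+_ (sum-cong-≗ {n} (λ i → ∑-const n (f i * f i))) (∑-const n Q) ⟩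
  ∑[ i < n ] (n * (f i * f i)) + n * Q                    ≡⟨ cong (_+ n * Q) (sym (*-distribˡ-sum n (λ i → f i * f i))) ⟩
  n * Q + n * Q                                           ≡⟨ cong (n * Q +_) (sym (+-identityʳ (n * Q))) ⟩
  2 * (n * Q)                                             ∎)
  where
  open ≤-Reasoning
  S = ∑[ i < n ] f i
  Q = ∑[ i < n ] (f i * f i)

any-allFin⁺ : ∀ {n} (p : Fin n → Bool) i → p i ≡ true → any p (allFin n) ≡ true
any-allFin⁺ p i pi = to T-≡ (any⁺ p (lose (∈-allFin i) (from T-≡ pi)))

any-allFin⁻ : ∀ {n} (p : Fin n → Bool) → any p (allFin n) ≡ true → ∃ λ i → p i ≡ true
any-allFin⁻ {n} p anyp with satisfied (any⁻ p (allFin n) (from T-≡ anyp))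
... | i , pi = i , to T-≡ pi

⟦any⟧≤∑ : ∀ {n} (p : Fin n → Bool) → ⟦ any p (allFin n) ⟧ ≤ ∑[ i < n ] ⟦ p i ⟧
⟦any⟧≤∑ {n} p with any p (allFin n) in anyp
... | false = z≤n
... | true with any-allFin⁻ p anyp
...   | i , pi = subst (λ b → ⟦ b ⟧ ≤ ∑[ j < n ] ⟦ p j ⟧) pi (≤-∑ (λ j → ⟦ p j ⟧) i)

separated-antimono : ∀ {n k l l'} (G : Matchings n k) → l ≤ l' →
                     Matchings.Separated G l' → Matchings.Separated G l
separated-antimono G l≤l' sep v = sep record
  { i = i ; t = t ; t≤l = ≤-trans t≤l l≤l' ; a = a ; walk = walk ; y = y ; w = w
  ; e∈Ei = e∈Ei ; f∈Ei = f∈Ei ; e≢f = e≢f }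
  where open Matchings.Violation v

module _ {N k : ℕ} (G : Matchings N k) where
  open Matchings G

  adj-sym : ∀ u v → adj u v ≡ adj v u
  adj-sym u v = cong or (map-cong (λ i → symmetric i u v) (allFin k))

  Edge-sym : ∀ {u v} → Edge u v → Edge v u
  Edge-sym {u} {v} = trans (adj-sym v u)

  M⇒Edge : ∀ {i u v} → M i u v ≡ true → Edge u v
  M⇒Edge {i} = any-allFin⁺ _ i

  Edge⇒M : ∀ {u v} → Edge u v → ∃ λ i → M i u v ≡ true
  Edge⇒M = any-allFin⁻ _

  no-triangle : Bipartite → ∀ {a b c} → Edge a b → Edge b c → Edge a c → ⊥
  no-triangle (colour , proper) ab bc ac =
    proper _ _ ac (trans (¬-not (proper _ _ ab)) (sym (¬-not (proper _ _ (Edge-sym bc)))))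

  deg : Fin N → ℕ
  deg u = ∑[ w < N ] ⟦ adj u w ⟧

  covers : Fin k → Fin N → ℕ
  covers i u = ∑[ w < N ] ⟦ M i u w ⟧

  covers≤1 : ∀ i u → covers i u ≤ 1
  covers≤1 i u = ∑-≤1 _ (λ w → ⟦⟧≤1 (M i u w))
    (λ w w' p q → matching i u w w' (⟦⟧-positive p) (⟦⟧-positive q))

  deg≤∑covers : ∀ u → deg u ≤ ∑[ i < k ] covers i u
  deg≤∑covers u = begin
    ∑[ w < N ] ⟦ adj u w ⟧                   ≤⟨ ∑-mono-≤ (λ w → ⟦any⟧≤∑ (λ i → M i u w)) ⟩
    ∑[ w < N ] ∑[ i < k ] ⟦ M i u w ⟧        ≡⟨ ∑-comm (λ w i → ⟦ M i u w ⟧) ⟩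
    ∑[ i < k ] covers i u                    ∎
    where open ≤-Reasoning

  counted : Fin N → Fin N → ℕ
  counted u v = if toℕ u <ᵇ toℕ v then ⟦ adj u v ⟧ else 0

  edgeCount-∑ : edgeCount ≡ ∑[ u < N ] ∑[ v < N ] counted u v
  edgeCount-∑ = trans (sum-allFin N _) (sum-cong-≗ {N} (λ u → sum-allFin N (counted u)))

  2*edgeCount≤∑deg : 2 * edgeCount ≤ ∑[ u < N ] deg u
  2*edgeCount≤∑deg = begin
    2 * edgeCount                                             ≡⟨ cong (2 *_) edgeCount-∑ ⟩
    2 * E                                                     ≡⟨ cong (E +_) (+-identityʳ E) ⟩
    E + E                                                     ≡⟨ cong (E +_) (∑-comm (λ u v → counted u v)) ⟩
    E + ∑[ u < N ] ∑[ v < N ] counted v u                     ≡⟨ ∑-distrib-+ (λ u → ∑[ v < N ] counted u v) _ ⟨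
    ∑[ u < N ] (∑[ v < N ] counted u v + ∑[ v < N ] counted v u)
                                                              ≡⟨ sum-cong-≗ {N} (λ u → ∑-distrib-+ (λ v → counted u v) _) ⟨
    ∑[ u < N ] ∑[ v < N ] (counted u v + counted v u)         ≤⟨ ∑-mono-≤ (λ u → ∑-mono-≤ (λ v → counted-both u v)) ⟩
    ∑[ u < N ] deg u                                          ∎
    where
    open ≤-Reasoning
    E = ∑[ u < N ] ∑[ v < N ] counted u v
    counted-both : ∀ u v → counted u v + counted v u ≤ ⟦ adj u v ⟧
    counted-both u v with toℕ u <ᵇ toℕ v in u<v | toℕ v <ᵇ toℕ u in v<u
    ... | true  | true  = ⊥-elim (<-asym (<ᵇ⇒< (toℕ u) (toℕ v) (from T-≡ u<v)) (<ᵇ⇒< (toℕ v) (toℕ u) (from T-≡ v<u)))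
    ... | true  | false = ≤-reflexive (+-identityʳ _)
    ... | false | true  = ≤-reflexive (cong ⟦_⟧ (adj-sym v u))
    ... | false | false = z≤n

  module _ (bipartite : Bipartite) (separated : Separated 2) where

    -- The two E_i-edges cannot coincide crosswise, as v u u' would then be a triangle.
    covered-neighbour-unique : ∀ {i v u u' w w'} → Edge v u → Edge v u' →
                               M i u w ≡ true → M i u' w' ≡ true → u ≡ u'
    covered-neighbour-unique {i} {v} {u} {u'} {w} {w'} vu vu' uw u'w' with u Fin.≟ u'
    ... | yes u≡u' = u≡u'
    ... | no  u≢u' = ⊥-elim (separated violation)
      where
      path : Fin 3 → Fin N
      path zero             = u
      path (suc zero)       = v
      path (suc (suc zero)) = u'
      walk : Walk 2 path
      walk zero       = Edge-sym vu
      walk (suc zero) = vu'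
      distinct : ¬ (((u ≡ u') × (w ≡ w')) ⊎ ((u ≡ w') × (w ≡ u')))
      distinct (inj₁ (u≡u' , _)) = u≢u' u≡u'
      distinct (inj₂ (refl , _)) = no-triangle bipartite vu' (M⇒Edge u'w') vu
      violation : Violation 2
      violation = record { i = i ; t = 2 ; t≤l = ≤-refl ; a = path ; walk = walk ; y = w ; w = w'
                         ; e∈Ei = uw ; f∈Ei = u'w' ; e≢f = distinct }

    ∑-neighbour-covers≤1 : ∀ v i → ∑[ u < N ] (⟦ adj v u ⟧ * covers i u) ≤ 1
    ∑-neighbour-covers≤1 v i = ∑-≤1 _ (λ u → *-mono-≤ (⟦⟧≤1 (adj v u)) (covers≤1 i u)) unique
      where
      witness : ∀ u → 0 < ⟦ adj v u ⟧ * covers i u → Edge v u × ∃ λ w → M i u w ≡ true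
      witness u 0<t with ⟦⟧*-positive (adj v u) _ 0<t
      ... | vu , 0<covers with ∑-positive _ 0<covers
      ...   | w , 0<uw = vu , w , ⟦⟧-positive 0<uw
      unique : ∀ u u' → 0 < ⟦ adj v u ⟧ * covers i u → 0 < ⟦ adj v u' ⟧ * covers i u' → u ≡ u'
      unique u u' p q with witness u p | witness u' q
      ... | vu , _ , uw | vu' , _ , u'w' = covered-neighbour-unique vu vu' uw u'w'

    ∑-neighbour-deg≤k : ∀ v → ∑[ u < N ] (⟦ adj v u ⟧ * deg u) ≤ k
    ∑-neighbour-deg≤k v = begin
      ∑[ u < N ] (⟦ adj v u ⟧ * deg u)                    ≤⟨ ∑-mono-≤ (λ u → *-monoʳ-≤ ⟦ adj v u ⟧ (deg≤∑covers u)) ⟩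
      ∑[ u < N ] (⟦ adj v u ⟧ * ∑[ i < k ] covers i u)    ≡⟨ sum-cong-≗ {N} (λ u → *-distribˡ-sum ⟦ adj v u ⟧ (λ i → covers i u)) ⟩
      ∑[ u < N ] ∑[ i < k ] (⟦ adj v u ⟧ * covers i u)    ≡⟨ ∑-comm (λ u i → ⟦ adj v u ⟧ * covers i u) ⟩
      ∑[ i < k ] ∑[ u < N ] (⟦ adj v u ⟧ * covers i u)    ≤⟨ ∑-mono-≤ (∑-neighbour-covers≤1 v) ⟩
      ∑[ i < k ] 1                                        ≡⟨ trans (∑-const k 1) (*-identityʳ k) ⟩
      k                                                   ∎
      where open ≤-Reasoning

    ∑-deg²≤N*k : ∑[ u < N ] (deg u * deg u) ≤ N * k
    ∑-deg²≤N*k = begin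
      ∑[ u < N ] (deg u * deg u)                          ≡⟨ sum-cong-≗ {N} (λ u → cong (_* deg u) (sum-cong-≗ {N} (λ v → cong ⟦_⟧ (adj-sym u v)))) ⟩
      ∑[ u < N ] (∑[ v < N ] ⟦ adj v u ⟧ * deg u)         ≡⟨ sum-cong-≗ {N} (λ u → *-distribʳ-sum (deg u) (λ v → ⟦ adj v u ⟧)) ⟩
      ∑[ u < N ] ∑[ v < N ] (⟦ adj v u ⟧ * deg u)         ≡⟨ ∑-comm (λ u v → ⟦ adj v u ⟧ * deg u) ⟩
      ∑[ v < N ] ∑[ u < N ] (⟦ adj v u ⟧ * deg u)         ≤⟨ ∑-mono-≤ ∑-neighbour-deg≤k ⟩
      ∑[ v < N ] k                                        ≡⟨ ∑-const N k ⟩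
      N * k                                               ∎
      where open ≤-Reasoning

    edgeCount-bound : 2 * edgeCount * (2 * edgeCount) ≤ N * (N * k)
    edgeCount-bound = begin
      2 * edgeCount * (2 * edgeCount)                     ≤⟨ *-mono-≤ 2*edgeCount≤∑deg 2*edgeCount≤∑deg ⟩
      ∑[ u < N ] deg u * ∑[ u < N ] deg u                 ≤⟨ ∑²≤n*∑-squares deg ⟩
      N * ∑[ u < N ] (deg u * deg u)                      ≤⟨ *-monoʳ-≤ N ∑-deg²≤N*k ⟩
      N * (N * k)                                         ∎
      where open ≤-Reasoning

module _ {s : ℕ} .{{_ : NonZero s}} where

  digits-unique : ∀ {a b a' b'} → b < s → b' < s → a * s + b ≡ a' * s + b' → a ≡ a' × b ≡ b'
  digits-unique {a} {b} {a'} {b'} b<s b'<s eq = a≡a' , b≡b'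
    where
    last-digit : ∀ a b → b < s → (a * s + b) % s ≡ b
    last-digit a b b<s = trans (cong (_% s) (+-comm (a * s) b)) (trans ([m+kn]%n≡m%n b a s) (m<n⇒m%n≡m b<s))
    b≡b' = trans (sym (last-digit a b b<s)) (trans (cong (_% s) eq) (last-digit a' b' b'<s))
    a≡a' = *-cancelʳ-≡ a a' s (+-cancelʳ-≡ _ (a * s) (a' * s) (trans eq (cong (a' * s +_) (sym b≡b'))))

  /-%-injective : ∀ {x y} → x / s ≡ y / s → x % s ≡ y % s → x ≡ y
  /-%-injective {x} {y} x/s≡y/s x%s≡y%s = begin
    x                  ≡⟨ m≡m%n+[m/n]*n x s ⟩
    x % s + x / s * s  ≡⟨ cong₂ (λ r q → r + q * s) x%s≡y%s x/s≡y/s ⟩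
    y % s + y / s * s  ≡⟨ m≡m%n+[m/n]*n y s ⟨
    y                  ∎
    where open ≡-Reasoning

  digits<s*s : ∀ {a b} → a < s → b < s → a * s + b < s * s
  digits<s*s {a} {b} a<s b<s = begin-strict
    a * s + b  <⟨ +-monoʳ-< (a * s) b<s ⟩
    a * s + s  ≡⟨ +-comm (a * s) s ⟩
    suc a * s  ≤⟨ *-monoˡ-≤ s a<s ⟩
    s * s      ∎
    where open ≤-Reasoning

  /-unique : ∀ {x q} → q * s ≤ x → x < q * s + s → x / s ≡ q
  /-unique {x} {q} qs≤x x<qs+s = proj₁ (digits-unique (m%n<n x s) (m<n+o⇒m∸n<o x (q * s) x<qs+s) eq)
    where
    eq : x / s * s + x % s ≡ q * s + (x ∸ q * s)
    eq = trans (+-comm (x / s * s) (x % s)) (trans (sym (m≡m%n+[m/n]*n x s)) (sym (m+[n∸m]≡n qs≤x)))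

module Blocks (n s : ℕ) .{{_ : NonZero s}} (s*s≤n : s * s ≤ n) where

  -- Vertices below n form the left half, the others the right half; a vertex x in the right half
  -- sits at position x ∸ n. Block b of either half consists of the positions p with p / s ≡ b.
  -- Left and right blocks with the same index are joined completely, and the edge between
  -- block positions a and a' on the two sides gets colour a * s + a' < s * s ≤ n.

  Link : ℕ → Fin (2 * n) → Fin (2 * n) → Set
  Link i u v = toℕ u < n × n ≤ toℕ v × toℕ u / s ≡ (toℕ v ∸ n) / s × i ≡ toℕ u % s * s + (toℕ v ∸ n) % s

  link? : ∀ i u v → Dec (Link i u v)
  link? i u v = toℕ u <? n ×-dec n ≤? toℕ v ×-dec toℕ u / s ≟ (toℕ v ∸ n) / s
                ×-dec i ≟ toℕ u % s * s + (toℕ v ∸ n) % s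

  Coloured : Fin n → Fin (2 * n) → Fin (2 * n) → Set
  Coloured i u v = Link (toℕ i) u v ⊎ Link (toℕ i) v u

  coloured? : ∀ i u v → Dec (Coloured i u v)
  coloured? i u v = link? (toℕ i) u v ⊎-dec link? (toℕ i) v u

  M : Fin n → Fin (2 * n) → Fin (2 * n) → Bool
  M i u v = does (coloured? i u v)

  M-coloured : ∀ i u v → M i u v ≡ true → Coloured i u v
  M-coloured i u v Muv = invert (subst (Reflects (Coloured i u v)) Muv (Dec.proof (coloured? i u v)))

  block : Fin (2 * n) → ℕ
  block x with toℕ x <? n
  ... | yes _ = toℕ x / s
  ... | no  _ = (toℕ x ∸ n) / s

  block-left : ∀ {x} → toℕ x < n → block x ≡ toℕ x / s
  block-left {x} x<n with toℕ x <? n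
  ... | yes _   = refl
  ... | no  x≮n = ⊥-elim (x≮n x<n)

  block-right : ∀ {x} → n ≤ toℕ x → block x ≡ (toℕ x ∸ n) / s
  block-right {x} n≤x with toℕ x <? n
  ... | yes x<n = ⊥-elim (<⇒≱ x<n n≤x)
  ... | no  _   = refl

  link-block : ∀ {i u v} → Link i u v → block u ≡ block v
  link-block (u<n , n≤v , same-block , _) = trans (block-left u<n) (trans same-block (sym (block-right n≤v)))

  link-unique : ∀ {i u v u' v'} → Link i u v → Link i u' v' → block u ≡ block u' → u ≡ u' × v ≡ v'
  link-unique {i} {u} {v} {u'} {v'} (u<n , n≤v , uv , i≡) (u'<n , n≤v' , u'v' , i≡') bu≡bu' =
    Fin.toℕ-injective u≡u' , Fin.toℕ-injective (∸-cancelʳ-≡ n≤v n≤v' (/-%-injective v/s≡v'/s (proj₂ digits)))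
    where
    digits = digits-unique (m%n<n (toℕ v ∸ n) s) (m%n<n (toℕ v' ∸ n) s) (trans (sym i≡) i≡')
    u/s≡u'/s : toℕ u / s ≡ toℕ u' / s
    u/s≡u'/s = trans (sym (block-left u<n)) (trans bu≡bu' (block-left u'<n))
    u≡u' = /-%-injective u/s≡u'/s (proj₁ digits)
    v/s≡v'/s = trans (sym uv) (trans u/s≡u'/s u'v')

  coloured-unique : ∀ {i x y x' y'} → Coloured i x y → Coloured i x' y' → block x ≡ block x' →
                    (x ≡ x' × y ≡ y') ⊎ (x ≡ y' × y ≡ x')
  coloured-unique (inj₁ p) (inj₁ q) b = inj₁ (link-unique p q b)
  coloured-unique (inj₁ p) (inj₂ q) b = inj₂ (link-unique p q (trans b (sym (link-block q))))
  coloured-unique (inj₂ p) (inj₁ q) b with link-unique p q (trans (link-block p) b)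
  ... | y≡x' , x≡y' = inj₂ (x≡y' , y≡x')
  coloured-unique (inj₂ p) (inj₂ q) b with link-unique p q (trans (link-block p) (trans b (sym (link-block q))))
  ... | y≡y' , x≡x' = inj₁ (x≡x' , y≡y')

  matchings : Matchings (2 * n) n
  matchings = record
    { M         = M
    ; symmetric = λ i u v → does-⇔ (mk⇔ swap swap) (coloured? i u v) (coloured? i v u)
    ; loopless  = λ i u → dec-false (coloured? i u u) λ where
                    (inj₁ (u<n , n≤u , _)) → <⇒≱ u<n n≤u
                    (inj₂ (u<n , n≤u , _)) → <⇒≱ u<n n≤u
    ; matching  = λ i u v w Muv Muw → case coloured-unique (M-coloured i u v Muv) (M-coloured i u w Muw) refl of λ where
                    (inj₁ (_ , v≡w))   → v≡w
                    (inj₂ (u≡w , v≡u)) → trans v≡u u≡w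
    }

  open Matchings matchings using (Edge; Walk; Bipartite; Separated; module Violation; edgeCount)

  edge-block : ∀ {u v} → Edge u v → block u ≡ block v
  edge-block {u} {v} uv with Edge⇒M matchings uv
  ... | i , Muv with M-coloured i u v Muv
  ...   | inj₁ link = link-block link
  ...   | inj₂ link = sym (link-block link)

  walk-block : ∀ t (a : Fin (suc t) → Fin (2 * n)) → Walk t a → block (a zero) ≡ block (a (fromℕ t))
  walk-block zero    a walk = refl
  walk-block (suc t) a walk =
    trans (walk-block t (λ j → a (inject₁ j)) (λ j → walk (inject₁ j))) (edge-block (walk (fromℕ t)))

  bipartite : Bipartite
  bipartite = left , λ u v uv → proper (Edge⇒M matchings uv)
    where
    left : Fin (2 * n) → Bool
    left x = does (toℕ x <? n)
    opposite : ∀ {u v} → toℕ u < n → n ≤ toℕ v → left u ≢ left v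
    opposite {u} {v} u<n n≤v eq = true≢false (trans (sym (dec-true (toℕ u <? n) u<n))
                                    (trans eq (dec-false (toℕ v <? n) (≤⇒≯ n≤v))))
      where
      true≢false : true ≢ false
      true≢false ()
    proper : ∀ {u v} → (∃ λ i → M i u v ≡ true) → left u ≢ left v
    proper {u} {v} (i , Muv) with M-coloured i u v Muv
    ... | inj₁ (u<n , n≤v , _) = opposite u<n n≤v
    ... | inj₂ (v<n , n≤u , _) = opposite v<n n≤u ∘ sym

  separated : ∀ l → Separated l
  separated l v =
    e≢f (coloured-unique (M-coloured i (a zero) y e∈Ei) (M-coloured i (a (fromℕ t)) w f∈Ei) (walk-block t a walk))
    where open Violation v

  block-edges : ∀ u → toℕ u < n / s * s → s ≤ ∑[ v < 2 * n ] counted matchings u v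
  block-edges u u<cs = subst (_≤ ∑[ v < 2 * n ] counted matchings u v) (*-identityʳ s)
                         (interval-≤-∑ (counted matchings u) (n + b * s) s block-fits counted-in-partner-block)
    where
    b = toℕ u / s
    u<n : toℕ u < n
    u<n = <-≤-trans u<cs (m/n*n≤m n s)
    block-fits : n + b * s + s ≤ 2 * n
    block-fits = begin
      n + b * s + s   ≡⟨ +-assoc n (b * s) s ⟩
      n + (b * s + s) ≡⟨ cong (n +_) (+-comm (b * s) s) ⟩
      n + suc b * s   ≤⟨ +-monoʳ-≤ n (≤-trans (*-monoˡ-≤ s (m<n*o⇒m/o<n {n = n / s} u<cs)) (m/n*n≤m n s)) ⟩
      n + n           ≡⟨ cong (n +_) (+-identityʳ n) ⟨
      2 * n           ∎
      where open ≤-Reasoning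
    counted-in-partner-block : ∀ v → n + b * s ≤ toℕ v → toℕ v < n + b * s + s → 1 ≤ counted matchings u v
    counted-in-partner-block v lo≤v v<hi = ≤-reflexive (cong₂ (λ lt e → if lt then ⟦ e ⟧ else 0) (sym u<v) (sym uv))
      where
      n≤v : n ≤ toℕ v
      n≤v = m+n≤o⇒m≤o n lo≤v
      r = toℕ v ∸ n
      r/s≡b : r / s ≡ b
      r/s≡b = /-unique (m+n≤o⇒m≤o∸n (b * s) (subst (_≤ toℕ v) (+-comm n (b * s)) lo≤v))
                       (subst (r <_) (m+n∸m≡n n (b * s + s)) (∸-monoˡ-< (subst (toℕ v <_) (+-assoc n (b * s) s) v<hi) n≤v))
      colour<n : toℕ u % s * s + r % s < n
      colour<n = <-≤-trans (digits<s*s (m%n<n (toℕ u) s) (m%n<n r s)) s*s≤n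
      i = fromℕ< colour<n
      link : Link (toℕ i) u v
      link = u<n , n≤v , sym r/s≡b , Fin.toℕ-fromℕ< colour<n
      uv : Matchings.adj matchings u v ≡ true
      uv = M⇒Edge matchings {i} {u} {v} (dec-true (coloured? i u v) (inj₁ link))
      u<v : (toℕ u <ᵇ toℕ v) ≡ true
      u<v = to T-≡ (<⇒<ᵇ (<-≤-trans u<n n≤v))

  edgeCount-≥ : n / s * s * s ≤ edgeCount
  edgeCount-≥ = subst (n / s * s * s ≤_) (sym (edgeCount-∑ matchings))
    (interval-≤-∑ _ 0 (n / s * s) (≤-trans (m/n*n≤m n s) (m≤m+n n (n + 0))) (λ u _ u<cs → block-edges u u<cs))

  admissible : ∀ l → Admissible l (2 * n) n
  admissible l = record { matchings = matchings ; bipartite = bipartite ; separated = separated l }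

integer-sqrt : ∀ n → ∃ λ s → s * s ≤ n × n < suc s * suc s
integer-sqrt zero    = 0 , z≤n , z<s
integer-sqrt (suc n) with integer-sqrt n
... | s , s²≤n , n<[s+1]² with suc n <? suc s * suc s
...   | yes n+1<[s+1]² = s , m≤n⇒m≤1+n s²≤n , n+1<[s+1]²
...   | no  n+1≮[s+1]² = suc s , ≤-reflexive (sym n+1≡[s+1]²) ,
                       subst (_< suc (suc s) * suc (suc s)) (sym n+1≡[s+1]²) (square-< s)
  where
  n+1≡[s+1]² : suc n ≡ suc s * suc s
  n+1≡[s+1]² = ≤-antisym n<[s+1]² (≮⇒≥ n+1≮[s+1]²)
  square-< : ∀ s → suc s * suc s < suc (suc s) * suc (suc s)
  square-< s = subst (suc s * suc s <_) (expand s) (m<m+n (suc s * suc s) {3 + 2 * s} z<s)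
    where
    expand : ∀ s → suc s * suc s + (3 + 2 * s) ≡ suc (suc s) * suc (suc s)
    expand = solve-∀

upper-arithmetic : ∀ k e n → 2 * e * (2 * e) ≤ 2 * n * (2 * n * n) → (k + 1) * e ^ 2 ≤ (k + 2) * n ^ 3
upper-arithmetic k e n bound =
  ≤-trans (*-monoʳ-≤ (k + 1) e²≤n³) (*-monoˡ-≤ (n ^ 3) (+-monoʳ-≤ k (s≤s z≤n)))
  where
  lhs : ∀ e → 2 * e * (2 * e) ≡ 4 * (e * (e * 1))
  lhs = solve-∀
  rhs : ∀ n → 2 * n * (2 * n * n) ≡ 4 * (n * (n * (n * 1)))
  rhs = solve-∀
  e²≤n³ : e ^ 2 ≤ n ^ 3
  e²≤n³ = *-cancelˡ-≤ 4 (subst₂ _≤_ (lhs e) (rhs n) bound)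

k[1+c]³≤[k+1]c²s : ∀ k c s → 9 * k + 2 ≤ c → c ≤ 2 + s → k * (suc c * (suc c * suc c)) ≤ (k + 1) * (c * c) * s
k[1+c]³≤[k+1]c²s k c s 9k+2≤c c≤2+s = +-cancelʳ-≤ (2 * ((k + 1) * (c * c))) _ _ (begin
  k * (suc c * (suc c * suc c)) + 2 * ((k + 1) * (c * c))     ≡⟨ expand k c ⟩
  k * (c * (c * c)) + ((5 * k + 2) * (c * c) + 3 * k * c + k) ≤⟨ +-monoʳ-≤ (k * (c * (c * c))) lower-order ⟩
  k * (c * (c * c)) + c * (c * c)                             ≡⟨ collect k c ⟩
  (k + 1) * (c * c) * c                                       ≤⟨ *-monoʳ-≤ ((k + 1) * (c * c)) c≤2+s ⟩
  (k + 1) * (c * c) * (2 + s)                                 ≡⟨ distribute ((k + 1) * (c * c)) s ⟩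
  (k + 1) * (c * c) * s + 2 * ((k + 1) * (c * c))             ∎)
  where
  open ≤-Reasoning
  1≤c : 1 ≤ c
  1≤c = ≤-trans (s≤s z≤n) (≤-trans (≤-reflexive (+-comm 2 (9 * k))) 9k+2≤c)
  c≤c² : c ≤ c * c
  c≤c² = subst (_≤ c * c) (*-identityʳ c) (*-monoʳ-≤ c 1≤c)
  lower-order : (5 * k + 2) * (c * c) + 3 * k * c + k ≤ c * (c * c)
  lower-order = begin
    (5 * k + 2) * (c * c) + 3 * k * c + k              ≤⟨ +-mono-≤ (+-monoʳ-≤ ((5 * k + 2) * (c * c)) (*-monoʳ-≤ (3 * k) c≤c²))
                                                                   (subst (_≤ k * (c * c)) (*-identityʳ k) (*-monoʳ-≤ k (≤-trans 1≤c c≤c²))) ⟩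
    (5 * k + 2) * (c * c) + 3 * k * (c * c) + k * (c * c) ≡⟨ sum-coefficients k (c * c) ⟩
    (9 * k + 2) * (c * c)                              ≤⟨ *-monoˡ-≤ (c * c) 9k+2≤c ⟩
    c * (c * c)                                        ∎
    where
    sum-coefficients : ∀ k x → (5 * k + 2) * x + 3 * k * x + k * x ≡ (9 * k + 2) * x
    sum-coefficients = solve-∀
  expand : ∀ k c → k * (suc c * (suc c * suc c)) + 2 * ((k + 1) * (c * c)) ≡
                   k * (c * (c * c)) + ((5 * k + 2) * (c * c) + 3 * k * c + k)
  expand = solve-∀
  collect : ∀ k c → k * (c * (c * c)) + c * (c * c) ≡ (k + 1) * (c * c) * c
  collect = solve-∀
  distribute : ∀ x s → x * (2 + s) ≡ x * s + 2 * x
  distribute = solve-∀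

-- With c = n / s blocks, n < (c + 1) s and e ≥ c s², so it suffices that k (c + 1)³ ≤ (k + 1) c² s.
lower-arithmetic : ∀ k n s e .{{_ : NonZero s}} → s * s ≤ n → n < suc s * suc s → 9 * k + 2 ≤ s →
                   n / s * s * s ≤ e → k * n ^ 3 ≤ (k + 1) * e ^ 2
lower-arithmetic k n s e s²≤n n<[s+1]² 9k+2≤s cs²≤e = begin
  k * n ^ 3                                  ≤⟨ *-monoʳ-≤ k (^-monoˡ-≤ 3 (<⇒≤ n<[c+1]s)) ⟩
  k * (suc c * s) ^ 3                        ≡⟨ split k c s ⟩
  k * (suc c * (suc c * suc c)) * (s * (s * s)) ≤⟨ *-monoˡ-≤ (s * (s * s)) (k[1+c]³≤[k+1]c²s k c s (≤-trans 9k+2≤s s≤c) c≤2+s) ⟩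
  (k + 1) * (c * c) * s * (s * (s * s))      ≡⟨ merge k c s ⟩
  (k + 1) * (c * s * s) ^ 2                  ≤⟨ *-monoʳ-≤ (k + 1) (^-monoˡ-≤ 2 cs²≤e) ⟩
  (k + 1) * e ^ 2                            ∎
  where
  open ≤-Reasoning
  c = n / s
  n<[c+1]s : n < suc c * s
  n<[c+1]s = begin-strict
    n          ≡⟨ m≡m%n+[m/n]*n n s ⟩
    n % s + c * s <⟨ +-monoˡ-< (c * s) (m%n<n n s) ⟩
    s + c * s  ∎
  s≤c : s ≤ c
  s≤c = <⇒≤pred (*-cancelʳ-< s s (suc c) (≤-<-trans s²≤n n<[c+1]s))
  c≤2+s : c ≤ 2 + s
  c≤2+s = *-cancelʳ-≤ c (2 + s) s (≤-trans (m/n*n≤m n s) (subst (n ≤_) (factor s) (<⇒≤pred n<[s+1]²)))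
    where
    factor : ∀ s → s + s * suc s ≡ (2 + s) * s
    factor = solve-∀
  split : ∀ k c s → k * (suc c * s * (suc c * s * (suc c * s * 1))) ≡ k * (suc c * (suc c * suc c)) * (s * (s * s))
  split = solve-∀
  merge : ∀ k c s → (k + 1) * (c * c) * s * (s * (s * s)) ≡ (k + 1) * (c * s * s * (c * s * s * 1))
  merge = solve-∀

theorem2 : ∀ (l : ℕ) → 2 ≤ l → ∀ (k : ℕ) → Σ ℕ λ N → ∀ (n : ℕ) → N ≤ n →
    ((G : Admissible l (2 * n) n) → (k + 1) * (Admissible.edges G ^ 2) ≤ (k + 2) * (n ^ 3))
    × Σ (Admissible l (2 * n) n) λ G → k * (n ^ 3) ≤ (k + 1) * (Admissible.edges G ^ 2)
theorem2 l 2≤l k = (9 * k + 2) * (9 * k + 2) , λ n N≤n → upper n , lower n N≤n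
  where
  upper : ∀ n (G : Admissible l (2 * n) n) → (k + 1) * (Admissible.edges G ^ 2) ≤ (k + 2) * (n ^ 3)
  upper n G = upper-arithmetic k edges n
                (edgeCount-bound matchings bipartite (separated-antimono matchings 2≤l separated))
    where open Admissible G

  lower : ∀ n → (9 * k + 2) * (9 * k + 2) ≤ n →
          Σ (Admissible l (2 * n) n) λ G → k * (n ^ 3) ≤ (k + 1) * (Admissible.edges G ^ 2)
  lower n N≤n with integer-sqrt n
  ... | s , s²≤n , n<[s+1]² = Blocks.admissible n s s²≤n l ,
                              lower-arithmetic k n s _ s²≤n n<[s+1]² 9k+2≤s (Blocks.edgeCount-≥ n s s²≤n)
    where
    9k+2≤s : 9 * k + 2 ≤ s
    9k+2≤s = ≮⇒≥ λ s<9k+2 → <-irrefl refl (<-≤-trans n<[s+1]² (≤-trans (*-mono-≤ s<9k+2 s<9k+2) N≤n))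
    instance
      s≢0 : NonZero s
      s≢0 = >-nonZero (<-≤-trans z<s (≤-trans (m≤n+m 2 (9 * k)) 9k+2≤s))
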